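{- Let $(G,L)$ be a minimal list-obstruction, and assume that $(G,L)$ has a semi-dominating set $A$ with $|A|\le t$. Assume also that whenever $G'$ is an induced subgraph of $G$ and $L'$ is a list system of $G'$ with $L'(v)\subseteq L(v)$ and $|L'(v)|\le 2$ for every $v\in V(G')$ such that $(G',L')$ is a minimal list-obstruction, then $|V(G')|\le m$. Then $|V(G)|\le 36\cdot 3^t\cdot m+t$.
   Context: A list system $L$ of a finite simple graph $G$ assigns to each vertex a set $L(v)\subseteq\{1,2,3\}$; an $L$-coloring is a proper coloring $c$ with $c(v)\in L(v)$; $(G,L)$ is a minimal list-obstruction if it has no $L$-coloring but every proper induced subgraph does (with restricted lists). Updating with respect to a set $X$ of vertices with lists of size at most one: let $X_0=X$, $L_0=L$; for $i\ge1$, $L_i$ is obtained from $L_{i-1}$ by removing from $L_{i-1}(v)$, for each $v\notin X_{i-1}$, every color $a$ such that $v$ has a neighbor $x\in X_{i-1}$ with $L_{i-1}(x)=\{a\}$, and $X_i=X_{i-1}\cup\{v\notin X_{i-1}:|L_i(v)|\le1,\ |L_{i-1}(v)|>1\}$; if two adjacent vertices of $X_{i-1}$ have the same list or some $L_i(v)=\emptyset$, set $L_i(v)=\emptyset$ for all $v\notin X_i$. Updating three times yields $L_3$. For $A\subseteq V(G)$ and an $L$-coloring $c$ of $G|A$, let $L_c$ be obtained by setting $L_c(v)=\{c(v)\}$ for $v\in A$, $L_c(v)=L(v)$ otherwise, and updating with respect to $A$ three times. $A$ is a semi-dominating set of $(G,L)$ if for every $L$-coloring $c$ of $G|A$, $|L_c(v)|\le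 2$ for every $v\in V(G)$. -}

module Defs where

open import Data.Nat using (ℕ; zero; suc; _≤_; _≤ᵇ_; _<ᵇ_; _≡ᵇ_)
open import Data.Bool using (Bool; true; false; _∧_; _∨_; not; if_then_else_)
open import Data.Fin using (Fin)
open import Data.Fin.Subset public using (Subset; _∈_; _∉_; _⊆_; _⊂_; ∣_∣; ⁅_⁆; ⊤; ⊥)
import Data.Fin.Subset as S
open import Data.Vec using (lookup; tabulate)
open import Data.Vec.Properties using (≡-dec)
open import Data.List using (allFin)
open import Data.Bool.ListAction using (any)
open import Data.Product using (Σ; ∃; _×_; _,_)
open import Relation.Nullary using (¬_; does)
open import Relation.Binary.PropositionalEquality using (_≡_; _≢_)
import Data.Bool.Properties as BP

record Graph (n : ℕ) : Set where
  field
    adj   : Fin n → Fin n → Bool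
    sym   : ∀ u v → adj u v ≡ adj v u
    irrefl : ∀ v → adj v v ≡ false
open Graph public

-- Colours {1,2,3} are represented by Fin 3; a list is a subset of Fin 3.
ListSys : ℕ → Set
ListSys n = Fin n → Subset 3

IsColoring : ∀ {n} → Graph n → ListSys n → Subset n → (Fin n → Fin 3) → Set
IsColoring G L S c =
  (∀ v → v ∈ S → c v ∈ L v) ×
  (∀ u v → u ∈ S → v ∈ S → adj G u v ≡ true → c u ≢ c v)

Colorable : ∀ {n} → Graph n → ListSys n → Subset n → Set
Colorable G L S = ∃ λ c → IsColoring G L S c

MinObs : ∀ {n} → Graph n → ListSys n → Subset n → Set
MinObs G L S = ¬ Colorable G L S × (∀ T → T ⊂ S → Colorable G L T)

mem : ∀ {n} → Subset n → Fin n → Bool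
mem X v = lookup X v

_==ˢ_ : Subset 3 → Subset 3 → Bool
a ==ˢ b = does (≡-dec BP._≟_ a b)

updateStep : ∀ {n} → Graph n → ListSys n × Subset n → ListSys n × Subset n
updateStep {n} G (L , X) = L'' , X'
  where
  vs = allFin n
  removed : Fin n → Fin 3 → Bool
  removed v a = any (λ x → mem X x ∧ adj G v x ∧ (L x ==ˢ ⁅ a ⁆)) vs
  L' : ListSys n
  L' v = if mem X v then L v
         else tabulate (λ a → lookup (L v) a ∧ not (removed v a))
  newX : Fin n → Bool
  newX v = mem X v ∨ ((∣ L' v ∣ ≤ᵇ 1) ∧ (1 <ᵇ ∣ L v ∣))
  X' : Subset n
  X' = tabulate newX
  bad : Bool
  bad = any (λ x → any (λ y → mem X x ∧ mem X y ∧ adj G x y ∧ (L x ==ˢ L y)) vs) vs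
        ∨ any (λ v → ∣ L' v ∣ ≡ᵇ 0) vs
  L'' : ListSys n
  L'' v = if bad ∧ not (newX v) then ⊥ else L' v

update3 : ∀ {n} → Graph n → ListSys n × Subset n → ListSys n × Subset n
update3 G p = updateStep G (updateStep G (updateStep G p))

Lc : ∀ {n} → Graph n → ListSys n → Subset n → (Fin n → Fin 3) → ListSys n
Lc G L A c = Data.Product.proj₁ (update3 G (L0 , A))
  where
  L0 : ListSys _
  L0 v = if mem A v then ⁅ c v ⁆ else L v

SemiDominating : ∀ {n} → Graph n → ListSys n → Subset n → Set
SemiDominating G L A =
  ∀ c → IsColoring G L A c → ∀ v → ∣ Lc G L A c v ∣ ≤ 2

module Submission where

-- Fix a colouring c of A. Every colour removed while updating is removed because of a single
-- vertex of X with a singleton list, so by induction over the three updates each list of L_c is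
-- certified by a small set: for every vertex v there are at most 22 vertices W_v such that every
-- L-colouring of a set containing A ∪ W_v that agrees with c on A colours v from L_c(v).
-- (G, L_c) has no colouring and lists of size at most 2, hence a minimal obstruction S_c with
-- |S_c| ≤ m, and A together with the union of the W_v (v ∈ S_c) admits no L-colouring agreeing
-- with c. Taking the union over all 3^|A| colourings of A gives a set with no L-colouring at all,
-- which by minimality of (G, L) is the whole vertex set.

open import Defs hiding (sym)
open import Data.Nat using (ℕ; zero; suc; _≤_; _+_; _*_; _^_; z≤n; s≤s; _≤ᵇ_; _<ᵇ_; _≡ᵇ_)
open import Data.Nat.Properties
open import Data.Fin using (Fin; zero; suc)
open import Data.Fin.Properties using (all?; any?) renaming (_≟_ to _≟ᶠ_)
open import Data.Fin.Subset using (_∪_; _-_; ⋃)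
open import Data.Fin.Subset.Properties
open import Data.Fin.Subset.Induction using (Acc; acc; ⊂-wellFounded)
open import Data.Bool using (Bool; true; false; T; _∧_; _∨_; not; if_then_else_)
open import Data.Bool.Properties using (T-∧; T-∨; T-≡) renaming (_≟_ to _≟ᵇ_)
open import Data.Bool.ListAction using (any)
open import Data.Vec using ([]; _∷_; here; there; lookup; tabulate)
open import Data.Vec.Properties using (lookup∘tabulate; []=⇒lookup; lookup⇒[]=; ≡-dec)
open import Data.Vec.Functional using () renaming (_∷_ to _◃_)
open import Data.List as List using (List; length; map; allFin; cartesianProductWith)
open import Data.List.Properties using (length-map; length-++)
open import Data.List.Relation.Unary.Any as Any using ()
open import Data.List.Relation.Unary.Any.Properties using (any⁻)
open import Data.List.Membership.Propositional using (lose) renaming (_∈_ to _∈ₗ_)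
open import Data.List.Membership.Propositional.Properties
  using (∈-map⁺; ∈-allFin; ∈-cartesianProductWith⁺)
open import Data.Product using (∃; ∃-syntax; _×_; _,_; proj₁; proj₂)
import Data.Sum as Sum
import Data.Empty as Empty
open import Data.Unit using (tt)
open import Function using (_∘_; case_of_)
open import Function.Bundles using (Equivalence)
open import Relation.Nullary using (¬_; Dec; yes; no; contradiction)
open import Relation.Nullary.Decidable using (_×-dec_; _→-dec_; ¬?; T?; toSum)
open import Relation.Binary.PropositionalEquality

private variable
  n : ℕ
  A B C : Set

∣p∪q∣≤∣p∣+∣q∣ : ∀ (p q : Subset n) → ∣ p ∪ q ∣ ≤ ∣ p ∣ + ∣ q ∣
∣p∪q∣≤∣p∣+∣q∣ []          []          = z≤n
∣p∪q∣≤∣p∣+∣q∣ (true ∷ p)  (true ∷ q)  =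
  s≤s (≤-trans (∣p∪q∣≤∣p∣+∣q∣ p q) (+-monoʳ-≤ ∣ p ∣ (n≤1+n ∣ q ∣)))
∣p∪q∣≤∣p∣+∣q∣ (true ∷ p)  (false ∷ q) = s≤s (∣p∪q∣≤∣p∣+∣q∣ p q)
∣p∪q∣≤∣p∣+∣q∣ (false ∷ p) (true ∷ q)  =
  subst (suc ∣ p ∪ q ∣ ≤_) (sym (+-suc ∣ p ∣ ∣ q ∣)) (s≤s (∣p∪q∣≤∣p∣+∣q∣ p q))
∣p∪q∣≤∣p∣+∣q∣ (false ∷ p) (false ∷ q) = ∣p∪q∣≤∣p∣+∣q∣ p q

∪-monoʳ-⊆ : ∀ (p : Subset n) {q r} → q ⊆ r → p ∪ q ⊆ p ∪ r
∪-monoʳ-⊆ p {q} q⊆r = x∈p∪q⁺ ∘ Sum.map₂ q⊆r ∘ x∈p∪q⁻ p q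

x∈p⇒1≤∣p∣ : ∀ {x : Fin n} {p} → x ∈ p → 1 ≤ ∣ p ∣
x∈p⇒1≤∣p∣ {x = x} {p} x∈p = begin
  1           ≡⟨ sym (∣⁅x⁆∣≡1 x) ⟩
  ∣ ⁅ x ⁆ ∣   ≤⟨ p⊆q⇒∣p∣≤∣q∣ (λ y∈⁅x⁆ → subst (_∈ p) (sym (x∈⁅y⁆⇒x≡y x y∈⁅x⁆)) x∈p) ⟩
  ∣ p ∣       ∎
  where open ≤-Reasoning

∣p∣≤1⇒x≡y : ∀ {x y : Fin n} {p} → ∣ p ∣ ≤ 1 → x ∈ p → y ∈ p → x ≡ y
∣p∣≤1⇒x≡y {x = x} {y} ∣p∣≤1 x∈p y∈p with x ≟ᶠ y
... | yes x≡y = x≡y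
... | no  x≢y = contradiction (≤-trans (x∈p⇒∣p-x∣<∣p∣ x∈p) ∣p∣≤1) λ 2≤1 →
  <-irrefl refl (≤-trans (s≤s (x∈p⇒1≤∣p∣ (x∈p∧x≢y⇒x∈p-y y∈p (x≢y ∘ sym)))) 2≤1)

elements : Subset n → List (Fin n)
elements []          = List.[]
elements (true ∷ p)  = zero List.∷ map suc (elements p)
elements (false ∷ p) = map suc (elements p)

length-elements : ∀ (p : Subset n) → length (elements p) ≡ ∣ p ∣
length-elements []          = refl
length-elements (true ∷ p)  = cong suc (trans (length-map suc (elements p)) (length-elements p))
length-elements (false ∷ p) = trans (length-map suc (elements p)) (length-elements p)

∈⇒∈-elements : ∀ {x : Fin n} {p} → x ∈ p → x ∈ₗ elements p
∈⇒∈-elements {p = true ∷ p}  here          = Any.here refl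
∈⇒∈-elements {p = true ∷ p}  (there x∈p)  = Any.there (∈-map⁺ suc (∈⇒∈-elements x∈p))
∈⇒∈-elements {p = false ∷ p} (there x∈p)  = ∈-map⁺ suc (∈⇒∈-elements x∈p)

∣⋃-map∣≤length*b : ∀ (F : A → Subset n) b → (∀ x → ∣ F x ∣ ≤ b) →
                   ∀ xs → ∣ ⋃ (map F xs) ∣ ≤ length xs * b
∣⋃-map∣≤length*b {n = n} F b ∣F∣≤b List.[] = ≤-reflexive (∣⊥∣≡0 n)
∣⋃-map∣≤length*b F b ∣F∣≤b (x List.∷ xs) =
  ≤-trans (∣p∪q∣≤∣p∣+∣q∣ (F x) _) (+-mono-≤ (∣F∣≤b x) (∣⋃-map∣≤length*b F b ∣F∣≤b xs))

⊆⋃-map : ∀ (F : A → Subset n) {x xs} → x ∈ₗ xs → F x ⊆ ⋃ (map F xs)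
⊆⋃-map F (Any.here refl)  = p⊆p∪q _
⊆⋃-map F {xs = y List.∷ _} (Any.there x∈xs) = q⊆p∪q (F y) _ ∘ ⊆⋃-map F x∈xs

length-cartesianProductWith : ∀ (f : A → B → C) xs ys →
  length (cartesianProductWith f xs ys) ≡ length xs * length ys
length-cartesianProductWith f List.[]         ys = refl
length-cartesianProductWith f (x List.∷ xs) ys = trans (length-++ (map (f x) ys))
  (cong₂ _+_ (length-map (f x) ys) (length-cartesianProductWith f xs ys))

AgreeOn : Subset n → (Fin n → A) → (Fin n → A) → Set
AgreeOn S f g = ∀ x → x ∈ S → f x ≡ g x

-- One representative, constant zero outside S, of each colouring of S.
assignments : Subset n → List (Fin n → Fin 3)
assignments []          = (λ ()) List.∷ List.[]
assignments (true ∷ S)  = cartesianProductWith _◃_ (allFin 3) (assignments S)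
assignments (false ∷ S) = map (zero ◃_) (assignments S)

length-assignments : ∀ (S : Subset n) → length (assignments S) ≡ 3 ^ ∣ S ∣
length-assignments []          = refl
length-assignments (true ∷ S)  =
  trans (length-cartesianProductWith _◃_ (allFin 3) (assignments S)) (cong (3 *_) (length-assignments S))
length-assignments (false ∷ S) = trans (length-map (zero ◃_) (assignments S)) (length-assignments S)

assignments-complete : ∀ (S : Subset n) f → ∃[ g ] g ∈ₗ assignments S × AgreeOn S f g
assignments-complete []          f = _ , Any.here refl , λ _ ()
assignments-complete (true ∷ S)  f with assignments-complete S (f ∘ suc)
... | g , g∈ , f≗g = f zero ◃ g , ∈-cartesianProductWith⁺ _◃_ (∈-allFin (f zero)) g∈ , agree
  where
  agree : AgreeOn (true ∷ S) f (f zero ◃ g)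
  agree zero    _           = refl
  agree (suc x) (there x∈S) = f≗g x x∈S
assignments-complete (false ∷ S) f with assignments-complete S (f ∘ suc)
... | g , g∈ , f≗g = zero ◃ g , ∈-map⁺ (zero ◃_) g∈ , λ { (suc x) (there x∈S) → f≗g x x∈S }

module Colorings (G : Graph n) where

  IsColoring-agree : ∀ {L S f g} → AgreeOn S f g → IsColoring G L S f → IsColoring G L S g
  IsColoring-agree {L = L} f≗g (f∈L , f-proper) =
    (λ v v∈S → subst (_∈ L v) (f≗g v v∈S) (f∈L v v∈S)) ,
    λ u v u∈S v∈S uv gu≡gv → f-proper u v u∈S v∈S uv
      (trans (f≗g u u∈S) (trans gu≡gv (sym (f≗g v v∈S))))

  IsColoring-⊆ : ∀ {L S T f} → T ⊆ S → IsColoring G L S f → IsColoring G L T f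
  IsColoring-⊆ T⊆S (f∈L , f-proper) =
    (λ v v∈T → f∈L v (T⊆S v∈T)) , λ u v u∈T v∈T → f-proper u v (T⊆S u∈T) (T⊆S v∈T)

  isColoring? : ∀ L S f → Dec (IsColoring G L S f)
  isColoring? L S f =
    all? (λ v → v ∈? S →-dec f v ∈? L v) ×-dec
    all? (λ u → all? λ v → u ∈? S →-dec (v ∈? S →-dec
      (adj G u v ≟ᵇ true →-dec ¬? (f u ≟ᶠ f v))))

  colorable? : ∀ L S → Dec (Colorable G L S)
  colorable? L S with Any.any? (isColoring? L S) (assignments S)
  ... | yes coloring = yes (Any.satisfied coloring)
  ... | no  none     = no λ (f , f-col) →
    let g , g∈ , f≗g = assignments-complete S f in none (lose g∈ (IsColoring-agree f≗g f-col))

  uncolorable⇒minObs : ∀ {L S} → ¬ Colorable G L S → ∃ (MinObs G L)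
  uncolorable⇒minObs {L} {S} = shrink S (⊂-wellFounded S)
    where
    shrink : ∀ S → Acc _⊂_ S → ¬ Colorable G L S → ∃ (MinObs G L)
    shrink S (acc smaller) ¬col with any? (λ x → x ∈? S ×-dec ¬? (colorable? L (S - x)))
    ... | yes (x , x∈S , ¬col-S-x) = shrink (S - x) (smaller (x∈p⇒p-x⊂p x∈S)) ¬col-S-x
    ... | no  critical = S , ¬col , properColorable
      where
      properColorable : ∀ T → T ⊂ S → Colorable G L T
      properColorable T (T⊆S , y , y∈S , y∉T) with colorable? L (S - y)
      ... | yes (f , f-col) = f , IsColoring-⊆ (λ z∈T → x∈p∧x≢y⇒x∈p-y (T⊆S z∈T) λ { refl → y∉T z∈T }) f-col
      ... | no  ¬col-S-y    = contradiction (y , y∈S , ¬col-S-y) critical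

  minObs-maximal : ∀ {L S T} → MinObs G L S → T ⊆ S → ¬ Colorable G L T → S ⊆ T
  minObs-maximal {T = T} (_ , properColorable) T⊆S ¬colT {x} x∈S with x ∈? T
  ... | yes x∈T = x∈T
  ... | no  x∉T = contradiction (properColorable T (T⊆S , x , x∈S , x∉T)) ¬colT

if-T : ∀ {b} {x y : A} → T b → (if b then x else y) ≡ x
if-T {b = true} _ = refl

if-¬T : ∀ {b} {x y : A} → ¬ T b → (if b then x else y) ≡ y
if-¬T {b = false} _  = refl
if-¬T {b = true}  ¬t = contradiction tt ¬t

¬T⇒T-not : ∀ {b} → ¬ T b → T (not b)
¬T⇒T-not {b = false} _  = tt
¬T⇒T-not {b = true}  ¬t = ¬t tt

T-not⇒¬T : ∀ {b} → T (not b) → ¬ T b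
T-not⇒¬T {b = false} _ ()

split-∧ : ∀ {x y} → T (x ∧ y) → T x × T y
split-∧ = Equivalence.to T-∧

==ˢ⇒≡ : ∀ {p q} → T (p ==ˢ q) → p ≡ q
==ˢ⇒≡ {p} {q} t with ≡-dec _≟ᵇ_ p q
... | yes p≡q = p≡q

∈-tabulate⁺ : ∀ {f : Fin n → Bool} {x} → T (f x) → x ∈ tabulate f
∈-tabulate⁺ {f = f} {x} fx = lookup⇒[]= x (tabulate f) (trans (lookup∘tabulate f x) (Equivalence.to T-≡ fx))

∈-tabulate⁻ : ∀ {f : Fin n → Bool} {x} → x ∈ tabulate f → T (f x)
∈-tabulate⁻ {f = f} {x} x∈ = Equivalence.from T-≡ (trans (sym (lookup∘tabulate f x)) ([]=⇒lookup x∈))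

T-mem⇒∈ : ∀ {X : Subset n} {v} → T (mem X v) → v ∈ X
T-mem⇒∈ {X = X} {v} t = lookup⇒[]= v X (Equivalence.to T-≡ t)

∈⇒T-mem : ∀ {X : Subset n} {v} → v ∈ X → T (mem X v)
∈⇒T-mem v∈X = Equivalence.from T-≡ ([]=⇒lookup v∈X)

-- The local definitions of updateStep in Defs, named so that updateStep G (L , X) is (L'' , X')
-- by definition.
module Update (G : Graph n) (L : ListSys n) (X : Subset n) where

  removed : Fin n → Fin 3 → Bool
  removed v a = any (λ x → mem X x ∧ adj G v x ∧ (L x ==ˢ ⁅ a ⁆)) (allFin n)

  kept : Fin n → Fin 3 → Bool
  kept v a = lookup (L v) a ∧ not (removed v a)

  L' : ListSys n
  L' v = if mem X v then L v else tabulate (kept v)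

  newX : Fin n → Bool
  newX v = mem X v ∨ ((∣ L' v ∣ ≤ᵇ 1) ∧ (1 <ᵇ ∣ L v ∣))

  X' : Subset n
  X' = tabulate newX

  bad : Bool
  bad = any (λ x → any (λ y → mem X x ∧ mem X y ∧ adj G x y ∧ (L x ==ˢ L y)) (allFin n)) (allFin n)
        ∨ any (λ v → ∣ L' v ∣ ≡ᵇ 0) (allFin n)

  L'' : ListSys n
  L'' v = if bad ∧ not (newX v) then ⊥ else L' v

module Forcing (G : Graph n) (Lo : ListSys n) (A : Subset n) (c : Fin n → Fin 3) where

  Extends : Subset n → (Fin n → Fin 3) → Set
  Extends D φ = IsColoring G Lo D φ × AgreeOn A φ c

  Property : Set₁
  Property = Subset n → (Fin n → Fin 3) → Set

  record Forced (k : ℕ) (P : Property) : Set where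
    constructor forcedBy
    field
      support : Subset n
      small   : ∣ support ∣ ≤ k
      forces  : ∀ D φ → A ∪ support ⊆ D → Extends D φ → P D φ

  open Forced public

  Pinned : ℕ → Subset 3 → Fin n → Set
  Pinned k S v = Forced k (λ D φ → v ∈ D × φ v ∈ S)

  Refuted : ℕ → Set
  Refuted k = Forced k (λ _ _ → Empty.⊥)

  private variable
    k l : ℕ
    P Q : Property

  forced-by-A : (∀ D φ → A ⊆ D → Extends D φ → P D φ) → Forced 0 P
  forced-by-A P-A = forcedBy ⊥ (≤-reflexive (∣⊥∣≡0 n)) λ D φ A∪⊥⊆D → P-A D φ (A∪⊥⊆D ∘ p⊆p∪q ⊥)

  forced-by-vertex : ∀ v → Forced 1 (λ D φ → v ∈ D)
  forced-by-vertex v = forcedBy ⁅ v ⁆ (≤-reflexive (∣⁅x⁆∣≡1 v)) λ D φ A∪v⊆D _ → A∪v⊆D (q⊆p∪q A ⁅ v ⁆ (x∈⁅x⁆ v))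

  Forced-map : (∀ {D φ} → Extends D φ → P D φ → Q D φ) → Forced k P → Forced k Q
  Forced-map P⇒Q (forcedBy W small forces) =
    forcedBy W small λ D φ A∪W⊆D ext → P⇒Q ext (forces D φ A∪W⊆D ext)

  Forced-≤ : k ≤ l → Forced k P → Forced l P
  Forced-≤ k≤l (forcedBy W small forces) = forcedBy W (≤-trans small k≤l) forces

  Forced-× : Forced k P → Forced l Q → Forced (k + l) (λ D φ → P D φ × Q D φ)
  Forced-× (forcedBy W W-small W-forces) (forcedBy V V-small V-forces) =
    forcedBy (W ∪ V) (≤-trans (∣p∪q∣≤∣p∣+∣q∣ W V) (+-mono-≤ W-small V-small)) λ D φ A∪W∪V⊆D ext →
      W-forces D φ (A∪W∪V⊆D ∘ ∪-monoʳ-⊆ A (p⊆p∪q V)) ext ,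
      V-forces D φ (A∪W∪V⊆D ∘ ∪-monoʳ-⊆ A (q⊆p∪q W V)) ext

  Forced-all : ∀ {I : Set} {P : I → Property} → (∀ v → Forced k (P v)) →
               ∀ vs → Forced (length vs * k) (λ D φ → ∀ v → v ∈ₗ vs → P v D φ)
  Forced-all P-forced List.[]          = forced-by-A λ _ _ _ _ _ ()
  Forced-all P-forced (v List.∷ vs)   = Forced-map (λ _ (Pv , Pvs) → λ
    { _ (Any.here refl) → Pv ; w (Any.there w∈vs) → Pvs w w∈vs })
    (Forced-× (P-forced v) (Forced-all P-forced vs))

  extends-proper : ∀ {D φ u v} → Extends D φ → u ∈ D → v ∈ D → T (adj G u v) → φ u ≢ φ v
  extends-proper ext u∈D v∈D uv = proj₂ (proj₁ ext) _ _ u∈D v∈D (Equivalence.to T-≡ uv)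

  -- a and b bound the certificates of settled and of arbitrary vertices. An update turns (a, b)
  -- into (b + 3a, b + 3a + 1), so the three updates starting from (0, 1) reach (21, 22).
  record Sound (L : ListSys n) (X : Subset n) (a b : ℕ) : Set where
    field
      ⊆-original     : ∀ v → L v ⊆ Lo v
      settled-≤1     : ∀ v → v ∈ X → ∣ L v ∣ ≤ 1
      settled-pinned : ∀ v → v ∈ X → Pinned a (L v) v
      pinned         : ∀ v → Pinned b (L v) v

  module Step {L X a b} (sound : Sound L X a b) where
    open Update G L X
    open Sound sound

    exclusion : ∀ v col → Forced a (λ D φ → T (removed v col) → v ∈ D → φ v ≢ col)
    exclusion v col with T? (removed v col)
    ... | no ¬removed = Forced-≤ z≤n (forced-by-A λ _ _ _ _ removed → contradiction removed ¬removed)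
    ... | yes removed with Any.satisfied (any⁻ _ (allFin n) removed)
    ...   | x , x-removes with split-∧ x-removes
    ...     | x∈X , x-conds with split-∧ x-conds
    ...       | vx , Lx≡⁅col⁆ = Forced-map
      (λ {φ = φ} ext (x∈D , φx∈Lx) _ v∈D φv≡col → extends-proper ext v∈D x∈D vx
         (trans φv≡col (sym (x∈⁅y⁆⇒x≡y col (subst (φ x ∈_) (==ˢ⇒≡ Lx≡⁅col⁆) φx∈Lx)))))
      (settled-pinned x (T-mem⇒∈ x∈X))

    exclusions : ∀ v → Forced (3 * a) (λ D φ → ∀ col → T (removed v col) → v ∈ D → φ v ≢ col)
    exclusions v = Forced-map (λ _ excl col → excl col (∈-allFin col)) (Forced-all (exclusion v) (allFin 3))

    L'⊆L : ∀ v → L' v ⊆ L v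
    L'⊆L v with T? (mem X v)
    ... | yes v∈X = subst (_ ∈_) (if-T v∈X)
    ... | no  v∉X = T-mem⇒∈ ∘ proj₁ ∘ split-∧ ∘ ∈-tabulate⁻ {f = kept v} ∘ subst (_ ∈_) (if-¬T v∉X)

    pinned-L' : ∀ v → Pinned (b + 3 * a) (L' v) v
    pinned-L' v with T? (mem X v)
    ... | yes v∈X = subst (λ S → Pinned _ S v) (sym (if-T v∈X)) (Forced-≤ (m≤m+n b _) (pinned v))
    ... | no  v∉X = subst (λ S → Pinned _ S v) (sym (if-¬T v∉X)) (Forced-map
      (λ {φ = φ} _ ((v∈D , φv∈Lv) , excl) → v∈D ,
         ∈-tabulate⁺ {f = kept v} (Equivalence.from T-∧ (∈⇒T-mem φv∈Lv , ¬T⇒T-not λ r → excl (φ v) r v∈D refl)))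
      (Forced-× (pinned v) (exclusions v)))

    refuted-if-clash : ∀ {x y} → x ∈ X → y ∈ X → T (adj G x y) → L x ≡ L y → Refuted (a + a)
    refuted-if-clash {x} {y} x∈X y∈X xy Lx≡Ly = Forced-map
      (λ {φ = φ} ext ((x∈D , φx∈Lx) , (y∈D , φy∈Ly)) → extends-proper ext x∈D y∈D xy
         (∣p∣≤1⇒x≡y (settled-≤1 x x∈X) φx∈Lx (subst (φ y ∈_) (sym Lx≡Ly) φy∈Ly)))
      (Forced-× (settled-pinned x x∈X) (settled-pinned y y∈X))

    refuted-if-emptied : ∀ {w} → ∣ L' w ∣ ≡ 0 → Refuted (b + 3 * a)
    refuted-if-emptied {w} ∣L'w∣≡0 = Forced-map
      (λ _ (_ , φw∈L'w) → case subst (1 ≤_) ∣L'w∣≡0 (x∈p⇒1≤∣p∣ φw∈L'w) of λ ())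
      (pinned-L' w)

    refuted-if-bad : T bad → Refuted (b + 3 * a)
    refuted-if-bad isBad with Equivalence.to T-∨ isBad
    ... | Sum.inj₂ emptied with Any.satisfied (any⁻ _ (allFin n) emptied)
    ...   | w , L'w-empty = refuted-if-emptied (≡ᵇ⇒≡ _ 0 L'w-empty)
    refuted-if-bad isBad | Sum.inj₁ clash with Any.satisfied (any⁻ _ (allFin n) clash)
    ...   | x , x-clash with Any.satisfied (any⁻ _ (allFin n) x-clash)
    ...     | y , xy-clash with split-∧ xy-clash
    ...       | x∈X , rest with split-∧ rest
    ...         | y∈X , rest' with split-∧ rest'
    ...           | xy , Lx≡Ly = Forced-≤ (≤-trans (+-monoʳ-≤ a (m≤m+n a _)) (m≤n+m _ b))
      (refuted-if-clash (T-mem⇒∈ x∈X) (T-mem⇒∈ y∈X) xy (==ˢ⇒≡ Lx≡Ly))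

    L''⊆L' : ∀ v → L'' v ⊆ L' v
    L''⊆L' v with T? (bad ∧ not (newX v))
    ... | yes cleared = Empty.⊥-elim ∘ ∉⊥ ∘ subst (_ ∈_) (if-T cleared)
    ... | no  kept    = subst (_ ∈_) (if-¬T kept)

    L''≡L' : ∀ {v} → v ∈ X' → L'' v ≡ L' v
    L''≡L' {v} v∈X' = if-¬T {b = bad ∧ not (newX v)} λ cleared → T-not⇒¬T (proj₂ (split-∧ cleared)) (∈-tabulate⁻ {f = newX} v∈X')

    ∣L'∣≤1 : ∀ {v} → v ∈ X' → ∣ L' v ∣ ≤ 1
    ∣L'∣≤1 {v} v∈X' with T? (mem X v) | Equivalence.to T-∨ (∈-tabulate⁻ {f = newX} v∈X')
    ... | yes v∈X | _               = subst (λ S → ∣ S ∣ ≤ 1) (sym (if-T v∈X)) (settled-≤1 v (T-mem⇒∈ v∈X))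
    ... | no  v∉X | Sum.inj₁ v∈X    = contradiction v∈X v∉X
    ... | no  v∉X | Sum.inj₂ shrunk = ≤ᵇ⇒≤ _ 1 (proj₁ (split-∧ shrunk))

    sound-step : Sound L'' X' (b + 3 * a) (suc (b + 3 * a))
    sound-step = record
      { ⊆-original     = λ v → ⊆-original v ∘ L'⊆L v ∘ L''⊆L' v
      ; settled-≤1     = λ v v∈X' → subst (λ S → ∣ S ∣ ≤ 1) (sym (L''≡L' v∈X')) (∣L'∣≤1 v∈X')
      ; settled-pinned = λ v v∈X' → subst (λ S → Pinned _ S v) (sym (L''≡L' v∈X')) (pinned-L' v)
      ; pinned         = pinned''
      }
      where
      pinned'' : ∀ v → Pinned (suc (b + 3 * a)) (L'' v) v
      pinned'' v with T? (bad ∧ not (newX v))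
      ... | yes cleared = subst (λ S → Pinned _ S v) (sym (if-T cleared)) (Forced-map
        (λ _ (v∈D , contradictory) → v∈D , Empty.⊥-elim contradictory)
        (Forced-× (forced-by-vertex v) (refuted-if-bad (proj₁ (split-∧ cleared)))))
      ... | no  kept    = subst (λ S → Pinned _ S v) (sym (if-¬T kept)) (Forced-≤ (n≤1+n _) (pinned-L' v))

  sound-updateStep : ∀ {p a b} → Sound (proj₁ p) (proj₂ p) a b →
    Sound (proj₁ (updateStep G p)) (proj₂ (updateStep G p)) (b + 3 * a) (suc (b + 3 * a))
  sound-updateStep sound = Step.sound-step sound

  L₀ : ListSys n
  L₀ v = if mem A v then ⁅ c v ⁆ else Lo v

  sound-initial : IsColoring G Lo A c → Sound L₀ A 0 1
  sound-initial (c∈Lo , _) = record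
    { ⊆-original     = ⊆-original
    ; settled-≤1     = λ v v∈A → subst (λ S → ∣ S ∣ ≤ 1) (sym (if-T (∈⇒T-mem v∈A))) (≤-reflexive (∣⁅x⁆∣≡1 (c v)))
    ; settled-pinned = pinned-A
    ; pinned         = pinned
    }
    where
    ⊆-original : ∀ v → L₀ v ⊆ Lo v
    ⊆-original v with T? (mem A v)
    ... | yes v∈A = λ x∈L₀v → subst (_∈ Lo v) (sym (x∈⁅y⁆⇒x≡y (c v) (subst (_ ∈_) (if-T v∈A) x∈L₀v)))
                                 (c∈Lo v (T-mem⇒∈ v∈A))
    ... | no  v∉A = subst (_ ∈_) (if-¬T v∉A)

    pinned-A : ∀ v → v ∈ A → Pinned 0 (L₀ v) v
    pinned-A v v∈A = forced-by-A λ D φ A⊆D (_ , φ≗c) → A⊆D v∈A ,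
      subst (φ v ∈_) (sym (if-T (∈⇒T-mem v∈A))) (subst (_∈ ⁅ c v ⁆) (sym (φ≗c v v∈A)) (x∈⁅x⁆ (c v)))

    pinned : ∀ v → Pinned 1 (L₀ v) v
    pinned v with T? (mem A v)
    ... | yes v∈A = Forced-≤ z≤n (pinned-A v (T-mem⇒∈ v∈A))
    ... | no  v∉A = Forced-map
      (λ {φ = φ} ((φ∈Lo , _) , _) v∈D → v∈D , subst (φ v ∈_) (sym (if-¬T v∉A)) (φ∈Lo v v∈D))
      (forced-by-vertex v)

  sound-Lc : IsColoring G Lo A c → Sound (Lc G Lo A c) (proj₂ (update3 G (L₀ , A))) 21 22
  sound-Lc = sound-updateStep ∘ sound-updateStep ∘ sound-updateStep ∘ sound-initial

  Lc⊆ : IsColoring G Lo A c → ∀ v → Lc G Lo A c v ⊆ Lo v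
  Lc⊆ = Sound.⊆-original ∘ sound-Lc

  Lc-pinned : IsColoring G Lo A c → ∀ v → Pinned 22 (Lc G Lo A c v) v
  Lc-pinned = Sound.pinned ∘ sound-Lc

SublistObstructionsBounded : ∀ {n} → Graph n → ListSys n → ℕ → Set
SublistObstructionsBounded {n} G L m = ∀ (S : Subset n) (L' : ListSys n) →
  (∀ v → v ∈ S → (L' v ⊆ L v) × (∣ L' v ∣ ≤ 2)) → MinObs G L' S → ∣ S ∣ ≤ m

module Bound (G : Graph n) (L : ListSys n) (A : Subset n) where
  open Colorings G
  open module F = Forcing G L A using (Refuted; support; small; forces)

  size-bound : ∀ {k} → MinObs G L ⊤ → (∀ c → Refuted c k) → n ≤ ∣ A ∣ + 3 ^ ∣ A ∣ * k
  size-bound {k} minObs refuted = begin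
    n                                   ≡⟨ sym (∣⊤∣≡n n) ⟩
    ∣ ⊤ {n} ∣                           ≤⟨ p⊆q⇒∣p∣≤∣q∣ (minObs-maximal minObs ⊆⊤ uncolorable) ⟩
    ∣ A ∪ U ∣                           ≤⟨ ∣p∪q∣≤∣p∣+∣q∣ A U ⟩
    ∣ A ∣ + ∣ U ∣                       ≤⟨ +-monoʳ-≤ ∣ A ∣ (∣⋃-map∣≤length*b W k (small ∘ refuted) (assignments A)) ⟩
    ∣ A ∣ + length (assignments A) * k  ≡⟨ cong (λ l → ∣ A ∣ + l * k) (length-assignments A) ⟩
    ∣ A ∣ + 3 ^ ∣ A ∣ * k               ∎
    where
    open ≤-Reasoning
    W : (Fin n → Fin 3) → Subset n
    W = support ∘ refuted
    U : Subset n
    U = ⋃ (map W (assignments A))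
    uncolorable : ¬ Colorable G L (A ∪ U)
    uncolorable (φ , φ-col) with assignments-complete A φ
    ... | g , g∈ , φ≗g = forces (refuted g) (A ∪ U) φ (∪-monoʳ-⊆ A (⊆⋃-map W g∈)) (φ-col , φ≗g)

  Lc-obstruction : MinObs G L ⊤ → ∀ c → IsColoring G L A c → ∃ (MinObs G (Lc G L A c))
  Lc-obstruction minObs c col = uncolorable⇒minObs λ (ψ , ψ∈Lc , ψ-proper) →
    proj₁ minObs (ψ , (λ v v∈ → F.Lc⊆ c col v (ψ∈Lc v v∈)) , ψ-proper)

  obstruction-refuted : ∀ c → IsColoring G L A c → ∀ {S} → MinObs G (Lc G L A c) S →
                        Refuted c (22 * ∣ S ∣)
  obstruction-refuted c col {S} (uncolorable , _) =
    F.Forced-≤ c (≤-reflexive (trans (cong (_* 22) (length-elements S)) (*-comm ∣ S ∣ 22)))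
      (F.Forced-map c
        (λ {φ = φ} ((_ , φ-proper) , _) pins → uncolorable
           (φ , (λ v v∈S → proj₂ (pins v (∈⇒∈-elements v∈S))) ,
                λ u v u∈S v∈S → φ-proper u v (proj₁ (pins u (∈⇒∈-elements u∈S)))
                                             (proj₁ (pins v (∈⇒∈-elements v∈S)))))
        (F.Forced-all c (F.Lc-pinned c col) (elements S)))

  refuted-unless-coloring : ∀ c → ¬ IsColoring G L A c → Refuted c 0
  refuted-unless-coloring c ¬col = F.forced-by-A c λ D φ A⊆D (φ-col , φ≗c) →
    ¬col (IsColoring-agree φ≗c (IsColoring-⊆ A⊆D φ-col))

  all-colorings-refuted : MinObs G L ⊤ → SemiDominating G L A →
    ∀ {m} → SublistObstructionsBounded G L m → ∀ c → Refuted c (22 * m)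
  all-colorings-refuted minObs semiDominating {m} bounded c =
    Sum.[ refuted-if-coloring , F.Forced-≤ c z≤n ∘ refuted-unless-coloring c ]′ (toSum (isColoring? L A c))
    where
    refuted-if-coloring : IsColoring G L A c → Refuted c (22 * m)
    refuted-if-coloring col =
      let S , minS = Lc-obstruction minObs c col
          ∣S∣≤m = bounded S (Lc G L A c) (λ v _ → F.Lc⊆ c col v , semiDominating c col v) minS
      in F.Forced-≤ c (*-monoʳ-≤ 22 ∣S∣≤m) (obstruction-refuted c col minS)

lemma6 : ∀ {n} (G : Graph n) (L : ListSys n) (A : Subset n) (t m : ℕ) →
    MinObs G L ⊤ →
    SemiDominating G L A →
    ∣ A ∣ ≤ t →
    (∀ (S : Subset n) (L' : ListSys n) →
      (∀ v → v ∈ S → (L' v ⊆ L v) × (∣ L' v ∣ ≤ 2)) →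
      MinObs G L' S → ∣ S ∣ ≤ m) →
    n ≤ 36 * 3 ^ t * m + t
lemma6 {n} G L A t m minObs semiDominating ∣A∣≤t bounded = begin
  n                             ≤⟨ size-bound minObs (all-colorings-refuted minObs semiDominating {m} bounded) ⟩
  ∣ A ∣ + 3 ^ ∣ A ∣ * (22 * m)  ≤⟨ +-mono-≤ ∣A∣≤t (*-mono-≤ (^-monoʳ-≤ 3 ∣A∣≤t) (*-monoˡ-≤ m (m≤m+n 22 14))) ⟩
  t + 3 ^ t * (36 * m)          ≡⟨ +-comm t _ ⟩
  3 ^ t * (36 * m) + t          ≡⟨ cong (_+ t) (sym (*-assoc (3 ^ t) 36 m)) ⟩
  3 ^ t * 36 * m + t            ≡⟨ cong (λ k → k * m + t) (*-comm (3 ^ t) 36) ⟩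
  36 * 3 ^ t * m + t            ∎
  where
  open ≤-Reasoning
  open Bound G L A
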